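{- Let $G$ be a singleton-partition graph of order $n$ with $\delta(G)=1$ that contains a full vertex. Then: (a) If $n=2$, then $G=K_2$, $L_{\rm SCC}(G)=\infty$, and the $G$-SC chain is $K_2\to\overline{K}_2\to K_2\to\overline{K}_2\to\cdots$. (b) If $n>3$ and $L_{\rm SCC}(G)=1$, then the $G$-SC chain is $G\to K_1\cup K_{1,n-2}$. (c) If $n=3$, then $G=P_3$, $L_{\rm SCC}(G)=\infty$, and the $G$-SC chain is $P_3\to K_1\cup K_2\to P_3\to K_1\cup K_2\to\cdots$.
   Context: All graphs are finite and simple. A full vertex is a vertex adjacent to all other vertices. A set $D\subseteq V$ is dominating if every vertex not in $D$ has a neighbor in $D$. Two disjoint sets $A,B\subseteq V$ form a coalition if neither is dominating but $A\cup B$ is. A coalition partition of $G$ is a partition $\mathcal{P}$ of $V$ such that every member is either a dominating set of cardinality 1, or is not dominating and forms a coalition with some other member. The coalition graph ${\rm CG}(G,\mathcal{P})$ has vertex set $\mathcal{P}$, two members adjacent iff they form a coalition. $\Gamma_1$ is the partition of $V$ into singletons; $G$ is a singleton-partition graph (SP-graph) if $\Gamma_1$ is a coalition partition of $G$. A singleton coalition graph chain with initial graph $G_1$ is a sequence $G_1\to G_2\to\cdots$ where each graph having a successor is an SP-graph and its successor is ${\rm CG}(G_i,\Gamma_1)$ (up to isomorphism). The $G$-SC chain is such a chain starting at $G$ of maximum possible length (it continues as long as the current graph is an SP-graph; it is infinite if this never fails). Its length $L_{\rm SCC}(G)$ is $k-1$ for a chain $G_1\to\cdots\to G_k$ and $\infty$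 for an infinite chain, with the convention that if all graphs in the chain are isomorphic the length is $0$. $\overline{K}_m$ is the edgeless graph on $m$ vertices, $\cup$ is disjoint union. -}

module Defs where

open import Data.Nat using (ℕ; zero; suc; _+_; _≤_; _<_)
open import Data.Fin using (Fin; zero; suc; toℕ; splitAt; _≟_)
open import Data.Fin.Properties using (all?; any?)
open import Data.Sum using (_⊎_; inj₁; inj₂)
open import Data.Product using (_×_; _,_; ∃; proj₁; proj₂)
open import Data.Empty using (⊥)
open import Data.List using (List; length; filter; allFin)
open import Relation.Nullary using (¬_; Dec; yes; no)
open import Relation.Nullary.Decidable using (_×-dec_; _⊎-dec_; ¬?)
open import Relation.Unary using (Pred; ｛_｝; _∪_)
open import Relation.Binary.PropositionalEquality using (_≡_; _≢_; refl; sym)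
import Data.Nat.Properties as ℕP

record Graph (n : ℕ) : Set₁ where
  field
    adj     : Fin n → Fin n → Set
    adj?    : ∀ u v → Dec (adj u v)
    adj-sym : ∀ {u v} → adj u v → adj v u
    irrefl  : ∀ {v} → ¬ adj v v
open Graph public

record Iso {n m : ℕ} (G : Graph n) (H : Graph m) : Set where
  field
    to       : Fin n → Fin m
    from     : Fin m → Fin n
    from-to  : ∀ v → from (to v) ≡ v
    to-from  : ∀ w → to (from w) ≡ w
    pres     : ∀ u v → adj G u v → adj H (to u) (to v)
    refl'    : ∀ u v → adj H (to u) (to v) → adj G u v

deg : ∀ {n} → Graph n → Fin n → ℕ
deg {n} G v = length (filter (adj? G v) (allFin n))

MinDegree : ∀ {n} → Graph n → ℕ → Set
MinDegree G d = (∀ v → d ≤ deg G v) × ∃ λ v → deg G v ≡ d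

Full : ∀ {n} → Graph n → Fin n → Set
Full G v = ∀ u → u ≢ v → adj G v u

Dominating : ∀ {n} → Graph n → Pred (Fin n) _ → Set
Dominating {n} G D = ∀ v → D v ⊎ ∃ λ u → D u × adj G u v

Disjoint : ∀ {n} → Pred (Fin n) _ → Pred (Fin n) _ → Set
Disjoint A B = ∀ v → ¬ (A v × B v)

Coalition : ∀ {n} → Graph n → Pred (Fin n) _ → Pred (Fin n) _ → Set
Coalition G A B =
  Disjoint A B × ¬ Dominating G A × ¬ Dominating G B × Dominating G (A ∪ B)

-- Γ₁ (partition into singletons) is a coalition partition of G:
-- every member {v} is a dominating set of cardinality 1, or is not
-- dominating and forms a coalition with some other member {u}.
SP : ∀ {n} → Graph n → Set
SP G = ∀ v → Dominating G ｛ v ｝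
           ⊎ (¬ Dominating G ｛ v ｝ × ∃ λ u → u ≢ v × Coalition G ｛ v ｝ ｛ u ｝)

dominating? : ∀ {n} (G : Graph n) (D : Pred (Fin n) _) →
              (∀ v → Dec (D v)) → Dec (Dominating G D)
dominating? G D D? = all? (λ v → D? v ⊎-dec any? (λ u → D? u ×-dec adj? G u v))

disjoint? : ∀ {n} (A B : Pred (Fin n) _) → (∀ v → Dec (A v)) → (∀ v → Dec (B v)) →
            Dec (Disjoint A B)
disjoint? A B A? B? = all? (λ v → ¬? (A? v ×-dec B? v))

coalition? : ∀ {n} (G : Graph n) (A B : Pred (Fin n) _) →
             (∀ v → Dec (A v)) → (∀ v → Dec (B v)) → Dec (Coalition G A B)
coalition? G A B A? B? =
  disjoint? A B A? B? ×-dec (¬? (dominating? G A A?) ×-dec (¬? (dominating? G B B?)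
    ×-dec dominating? G (A ∪ B) (λ v → A? v ⊎-dec B? v)))

-- The singleton coalition graph CG(G, Γ₁); its vertex {v} is identified with v

∪-swap : ∀ {n} {G : Graph n} {A B : Pred (Fin n) _} →
         Dominating G (A ∪ B) → Dominating G (B ∪ A)
∪-swap d v with d v
... | inj₁ (inj₁ a) = inj₁ (inj₂ a)
... | inj₁ (inj₂ b) = inj₁ (inj₁ b)
... | inj₂ (u , inj₁ a , e) = inj₂ (u , inj₂ a , e)
... | inj₂ (u , inj₂ b , e) = inj₂ (u , inj₁ b , e)

CG : ∀ {n} → Graph n → Graph n
CG G = record
  { adj    = λ u v → Coalition G ｛ u ｝ ｛ v ｝
  ; adj?   = λ u v → coalition? G ｛ u ｝ ｛ v ｝ (λ w → u ≟ w) (λ w → v ≟ w)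
  ; adj-sym = λ { (dj , nu , nv , d) →
                 (λ w p → dj w (proj₂ p , proj₁ p)) , nv , nu , ∪-swap {G = G} d }
  ; irrefl = λ { {v} (dj , _) → dj v (refl , refl) }
  }

iter : ∀ {n} → ℕ → Graph n → Graph n
iter zero    G = G
iter (suc i) G = CG (iter i G)

-- the maximal chain is G_1 → ... → G_{k+1} (G_{i+1} = iter i G)
FiniteChain : ∀ {n} → Graph n → ℕ → Set
FiniteChain G k = (∀ i → i < k → SP (iter i G)) × ¬ SP (iter k G)

InfiniteChain : ∀ {n} → Graph n → Set
InfiniteChain G = ∀ i → SP (iter i G)

data ℕ∞ : Set where
  fin : ℕ → ℕ∞
  ∞   : ℕ∞

data LSCC {n} (G : Graph n) : ℕ∞ → Set₁ where
  finLen : ∀ k → FiniteChain G k → ¬ (∀ i → i ≤ k → Iso (iter i G) G) → LSCC G (fin k)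
  finIso : ∀ k → FiniteChain G k → (∀ i → i ≤ k → Iso (iter i G) G) → LSCC G (fin 0)
  infLen : InfiniteChain G → ¬ (∀ i → Iso (iter i G) G) → LSCC G ∞
  infIso : InfiniteChain G → (∀ i → Iso (iter i G) G) → LSCC G (fin 0)

K : (m : ℕ) → Graph m
K m = record
  { adj = λ u v → u ≢ v ; adj? = λ u v → ¬? (u ≟ v)
  ; adj-sym = λ p e → p (sym e) ; irrefl = λ p → p refl }

Kbar : (m : ℕ) → Graph m
Kbar m = record { adj = λ _ _ → ⊥ ; adj? = λ _ _ → no (λ ()) ; adj-sym = λ () ; irrefl = λ () }

P : (m : ℕ) → Graph m
P m = record
  { adj = λ u v → toℕ v ≡ suc (toℕ u) ⊎ toℕ u ≡ suc (toℕ v)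
  ; adj? = λ u v → (toℕ v ℕP.≟ suc (toℕ u)) ⊎-dec (toℕ u ℕP.≟ suc (toℕ v))
  ; adj-sym = λ { (inj₁ e) → inj₂ e ; (inj₂ e) → inj₁ e }
  ; irrefl = λ { (inj₁ e) → ℕP.1+n≢n (sym e) ; (inj₂ e) → ℕP.1+n≢n (sym e) } }

Star : (m : ℕ) → Graph (suc m)
Star m = record
  { adj = λ u v → (u ≡ zero × v ≢ zero) ⊎ (v ≡ zero × u ≢ zero)
  ; adj? = λ u v → ((u ≟ zero) ×-dec ¬? (v ≟ zero)) ⊎-dec ((v ≟ zero) ×-dec ¬? (u ≟ zero))
  ; adj-sym = λ { (inj₁ p) → inj₂ p ; (inj₂ p) → inj₁ p }
  ; irrefl = λ { (inj₁ (e , ne)) → ne e ; (inj₂ (e , ne)) → ne e } }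

module _ {m k : ℕ} (G : Graph m) (H : Graph k) where
  uadj : Fin m ⊎ Fin k → Fin m ⊎ Fin k → Set
  uadj (inj₁ a) (inj₁ b) = adj G a b
  uadj (inj₂ a) (inj₂ b) = adj H a b
  uadj _        _        = ⊥

  uadj? : ∀ x y → Dec (uadj x y)
  uadj? (inj₁ a) (inj₁ b) = adj? G a b
  uadj? (inj₂ a) (inj₂ b) = adj? H a b
  uadj? (inj₁ _) (inj₂ _) = no (λ ())
  uadj? (inj₂ _) (inj₁ _) = no (λ ())

  usym : ∀ x y → uadj x y → uadj y x
  usym (inj₁ a) (inj₁ b) p = Graph.adj-sym G p
  usym (inj₂ a) (inj₂ b) p = Graph.adj-sym H p

  uirr : ∀ x → ¬ uadj x x
  uirr (inj₁ a) = irrefl G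
  uirr (inj₂ a) = irrefl H

  _⊔_ : Graph (m + k)
  _⊔_ = record
    { adj = λ u v → uadj (splitAt m u) (splitAt m v)
    ; adj? = λ u v → uadj? (splitAt m u) (splitAt m v)
    ; adj-sym = λ {u} {v} → usym (splitAt m u) (splitAt m v)
    ; irrefl = λ {v} → uirr (splitAt m v) }

-- Let v be a full vertex and w a leaf of G (so w ≠ v once n ≥ 3, and v is the
-- only neighbour of w). Every dominating set meets {v, w}, and {v} is
-- dominating, so v is isolated in CG(G) and every coalition pair contains w.
-- Conversely, for u ∉ {v, w} the singleton {u} misses w, and the coalition
-- partner that Γ₁ must supply for it can only be w. Hence CG(G) is K₁ ∪ K_{1,n-2}
-- with v isolated and w the centre. For n = 2 and n = 3 the graph is forced
-- (K₂, resp. P₃), and the chain reduces to finite checks on two graphs whose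
-- coalition graphs are each other.
module Submission where

open import Defs
open import Data.Nat using (zero; suc; _*_; _<_; _∸_; s≤s)
open import Data.Nat.Properties using (*-suc)
open import Data.Fin using (Fin; zero; suc; _≟_; punchIn)
open import Data.Fin.Properties using (all?; any?; suc-injective; 0≢1+n; punchIn-injective; punchInᵢ≢i)
open import Data.Fin.Permutation using (Permutation; _⟨$⟩ʳ_; _⟨$⟩ˡ_; inverseˡ; inverseʳ; transpose; _∘ₚ_)
open import Data.List using (List; []; _∷_; length)
open import Data.List.Membership.Propositional using (_∈_)
open import Data.List.Membership.Propositional.Properties using (∈-filter⁺; ∈-allFin)
open import Data.List.Relation.Unary.Any using (here; there)
open import Data.Product using (_×_; ∃; _,_; proj₁; proj₂)
open import Data.Sum using (_⊎_; inj₁; inj₂; [_,_])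
open import Data.Empty using (⊥-elim)
open import Data.Unit using (tt)
open import Function using (_∘_; id)
open import Function.Bundles using (_⇔_; mk⇔; module Equivalence)
open import Relation.Nullary using (¬_; Dec; yes; no)
open import Relation.Nullary.Decidable using (True; toWitness; _×-dec_; _⊎-dec_; ¬?; _→-dec_; dec-true; dec-false)
open import Relation.Unary using (Pred; ｛_｝; _∪_)
open import Relation.Binary.PropositionalEquality using (_≡_; _≢_; refl; sym; trans; cong; subst; subst₂)

open Iso
open Equivalence using () renaming (to to forth; from to back)

Iso-sym : ∀ {n m} {G : Graph n} {H : Graph m} → Iso G H → Iso H G
Iso-sym {H = H} I = record
  { to = from I ; from = to I ; from-to = to-from I ; to-from = from-to I
  ; pres = λ u v a → refl' I (from I u) (from I v) (subst₂ (adj H) (sym (to-from I u)) (sym (to-from I v)) a)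
  ; refl' = λ u v a → subst₂ (adj H) (to-from I u) (to-from I v) (pres I _ _ a) }

Iso-trans : ∀ {n m k} {G : Graph n} {H : Graph m} {J : Graph k} → Iso G H → Iso H J → Iso G J
Iso-trans I I′ = record
  { to = to I′ ∘ to I ; from = from I ∘ from I′
  ; from-to = λ v → trans (cong (from I) (from-to I′ (to I v))) (from-to I v)
  ; to-from = λ w → trans (cong (to I′) (to-from I (from I′ w))) (to-from I′ w)
  ; pres = λ u v → pres I′ _ _ ∘ pres I u v
  ; refl' = λ u v → refl' I u v ∘ refl' I′ _ _ }

to-injective : ∀ {n m} {G : Graph n} {H : Graph m} (I : Iso G H) {a b} → to I a ≡ to I b → a ≡ b
to-injective I {a} {b} e = trans (sym (from-to I a)) (trans (cong (from I) e) (from-to I b))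

Dominating-along : ∀ {n m} {G : Graph n} {H : Graph m} (I : Iso G H)
                   {D : Pred (Fin n) _} {D′ : Pred (Fin m) _} →
                   (∀ x → D x → D′ (to I x)) → Dominating G D → Dominating H D′
Dominating-along {H = H} I {D′ = D′} D⇒D′ d y with d (from I y)
... | inj₁ Dx = inj₁ (subst D′ (to-from I y) (D⇒D′ _ Dx))
... | inj₂ (u , Du , a) =
  inj₂ (to I u , D⇒D′ u Du , subst (adj H (to I u)) (to-from I y) (pres I u (from I y) a))

¬Dominating-singleton-along : ∀ {n m} {G : Graph n} {H : Graph m} (I : Iso G H) {u} →
                              ¬ Dominating G ｛ u ｝ → ¬ Dominating H ｛ to I u ｝
¬Dominating-singleton-along I {u} ¬d =
  ¬d ∘ Dominating-along (Iso-sym I) (λ _ e → trans (sym (from-to I u)) (cong (from I) e))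

Coalition-along : ∀ {n m} {G : Graph n} {H : Graph m} (I : Iso G H) {u v} →
                  Coalition G ｛ u ｝ ｛ v ｝ → Coalition H ｛ to I u ｝ ｛ to I v ｝
Coalition-along I {u} (dj , ¬du , ¬dv , d) =
    (λ _ (e , e′) → dj u (refl , to-injective I (trans e′ (sym e))))
  , ¬Dominating-singleton-along I ¬du
  , ¬Dominating-singleton-along I ¬dv
  , Dominating-along I (λ _ → [ inj₁ ∘ cong (to I) , inj₂ ∘ cong (to I) ]) d

CG-cong : ∀ {n m} {G : Graph n} {H : Graph m} → Iso G H → Iso (CG G) (CG H)
CG-cong {G = G} I = record
  { to = to I ; from = from I ; from-to = from-to I ; to-from = to-from I
  ; pres = λ _ _ → Coalition-along I
  ; refl' = λ u v c → subst₂ (λ a b → Coalition G ｛ a ｝ ｛ b ｝) (from-to I u) (from-to I v)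
                             (Coalition-along (Iso-sym I) c) }

SP-along : ∀ {n m} {G : Graph n} {H : Graph m} → Iso G H → SP G → SP H
SP-along {H = H} I sp y with sp (from I y)
... | inj₁ d = inj₁ (Dominating-along I (λ _ e → trans (sym (to-from I y)) (cong (to I) e)) d)
... | inj₂ (¬d , u , u≢ , c) =
  inj₂ ( subst (λ z → ¬ Dominating H ｛ z ｝) (to-from I y) (¬Dominating-singleton-along I ¬d)
       , to I u , (λ e → u≢ (trans (sym (from-to I u)) (cong (from I) e)))
       , subst (λ z → Coalition H ｛ z ｝ ｛ to I u ｝) (to-from I y) (Coalition-along I c))

Isolated : ∀ {n} → Graph n → Fin n → Set
Isolated G x = ∀ y → ¬ adj G x y

Isolated-along : ∀ {n m} {G : Graph n} {H : Graph m} (I : Iso G H) {x} →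
                 Isolated G x → Isolated H (to I x)
Isolated-along {H = H} I {x} x-isolated y a =
  x-isolated (from I y) (refl' I x (from I y) (subst (adj H (to I x)) (sym (to-from I y)) a))

-- Small graphs, by decision

SP? : ∀ {n} (G : Graph n) → Dec (SP G)
SP? G = all? λ v → dominating? G ｛ v ｝ (v ≟_) ⊎-dec (¬? (dominating? G ｛ v ｝ (v ≟_))
          ×-dec any? λ u → ¬? (u ≟ v) ×-dec coalition? G ｛ v ｝ ｛ u ｝ (v ≟_) (u ≟_))

Isolated? : ∀ {n} (G : Graph n) x → Dec (Isolated G x)
Isolated? G x = all? λ y → ¬? (adj? G x y)

Iso-byDecision : ∀ {k} (X Y : Graph k) (f g : Fin k → Fin k) →
  True (all? λ v → g (f v) ≟ v) → True (all? λ w → f (g w) ≟ w) →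
  True (all? λ u → all? λ v → (adj? X u v →-dec adj? Y (f u) (f v))
                              ×-dec (adj? Y (f u) (f v) →-dec adj? X u v)) →
  Iso X Y
Iso-byDecision X Y f g gf fg adj⇔ = record
  { to = f ; from = g ; from-to = toWitness gf ; to-from = toWitness fg
  ; pres = λ u v → proj₁ (toWitness adj⇔ u v) ; refl' = λ u v → proj₂ (toWitness adj⇔ u v) }

K₁⊔K₂ : Graph 3
K₁⊔K₂ = K 1 ⊔ K 2

swap₀₁ : Fin 3 → Fin 3
swap₀₁ zero = suc zero
swap₀₁ (suc zero) = zero
swap₀₁ (suc (suc x)) = suc (suc x)

CG-K₂ : Iso (CG (K 2)) (Kbar 2)
CG-K₂ = Iso-byDecision _ _ id id tt tt tt

CG-K̄₂ : Iso (CG (Kbar 2)) (K 2)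
CG-K̄₂ = Iso-byDecision _ _ id id tt tt tt

CG-P₃ : Iso (CG (P 3)) K₁⊔K₂
CG-P₃ = Iso-byDecision _ _ swap₀₁ swap₀₁ tt tt tt

CG-K₁⊔K₂ : Iso (CG K₁⊔K₂) (P 3)
CG-K₁⊔K₂ = Iso-byDecision _ _ swap₀₁ swap₀₁ tt tt tt

Star₂≅P₃ : Iso (Star 2) (P 3)
Star₂≅P₃ = Iso-byDecision _ _ swap₀₁ swap₀₁ tt tt tt

SP-K₂ : SP (K 2)
SP-K₂ = toWitness {a? = SP? (K 2)} tt

SP-K̄₂ : SP (Kbar 2)
SP-K̄₂ = toWitness {a? = SP? (Kbar 2)} tt

SP-P₃ : SP (P 3)
SP-P₃ = toWitness {a? = SP? (P 3)} tt

SP-K₁⊔K₂ : SP K₁⊔K₂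
SP-K₁⊔K₂ = toWitness {a? = SP? K₁⊔K₂} tt

K₂-¬Isolated : ∀ x → ¬ Isolated (K 2) x
K₂-¬Isolated = toWitness {a? = all? λ x → ¬? (Isolated? (K 2) x)} tt

P₃-¬Isolated : ∀ x → ¬ Isolated (P 3) x
P₃-¬Isolated = toWitness {a? = all? λ x → ¬? (Isolated? (P 3) x)} tt

K₁⊔K₂-Isolated : Isolated K₁⊔K₂ zero
K₁⊔K₂-Isolated = toWitness {a? = Isolated? K₁⊔K₂ zero} tt

Fin2-pigeonhole : (a b v : Fin 2) → a ≢ b → a ≡ v ⊎ b ≡ v
Fin2-pigeonhole = toWitness {a? = all? λ a → all? λ b → all? λ v →
                    ¬? (a ≟ b) →-dec ((a ≟ v) ⊎-dec (b ≟ v))} tt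

Fin3-pigeonhole : (a b v w : Fin 3) → a ≢ b → a ≢ v → b ≢ v → w ≢ v → a ≡ w ⊎ b ≡ w
Fin3-pigeonhole = toWitness {a? = all? λ a → all? λ b → all? λ v → all? λ w →
                    ¬? (a ≟ b) →-dec (¬? (a ≟ v) →-dec (¬? (b ≟ v) →-dec (¬? (w ≟ v)
                    →-dec ((a ≟ w) ⊎-dec (b ≟ w)))))} tt

-- Chains of period two

module PeriodTwo {n k} {G : Graph n} {A B : Graph k}
                 (G≅A : Iso G A) (CG-A≅B : Iso (CG A) B) (CG-B≅A : Iso (CG B) A) where

  iter-even-odd : ∀ i → Iso (iter (2 * i) G) A × Iso (iter (suc (2 * i)) G) B
  iter-even-odd zero = G≅A , Iso-trans (CG-cong G≅A) CG-A≅B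
  iter-even-odd (suc i) =
    subst (λ j → Iso (iter j G) A × Iso (iter (suc j) G) B) (sym (*-suc 2 i))
          (even , Iso-trans (CG-cong even) CG-A≅B)
    where
    even : Iso (iter (suc (suc (2 * i))) G) A
    even = Iso-trans (CG-cong (proj₂ (iter-even-odd i))) CG-B≅A

  iter-A-or-B : ∀ i → Iso (iter i G) A ⊎ Iso (iter i G) B
  iter-A-or-B zero = inj₁ G≅A
  iter-A-or-B (suc i) =
    [ (λ I → inj₂ (Iso-trans (CG-cong I) CG-A≅B)) , (λ I → inj₁ (Iso-trans (CG-cong I) CG-B≅A)) ]
    (iter-A-or-B i)

  LSCC-∞ : SP A → SP B → ∀ {x} → Isolated B x → (∀ y → ¬ Isolated A y) → LSCC G ∞
  LSCC-∞ sp-A sp-B {x} x-isolated A-¬isolated =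
    infLen (λ i → [ (λ I → SP-along (Iso-sym I) sp-A) , (λ I → SP-along (Iso-sym I) sp-B) ]
                   (iter-A-or-B i))
           (λ iter≅G → A-¬isolated _ (Isolated-along (B≅A (iter≅G 1)) x-isolated))
    where
    B≅A : Iso (iter 1 G) G → Iso B A
    B≅A I = Iso-trans (Iso-sym (proj₂ (iter-even-odd 0))) (Iso-trans I G≅A)

adj⇒≢ : ∀ {n} (G : Graph n) {a b} → adj G a b → a ≢ b
adj⇒≢ G {a} x e = irrefl G (subst (adj G a) (sym e) x)

Full⇒Dominating : ∀ {n} {G : Graph n} {v} → Full G v → Dominating G ｛ v ｝
Full⇒Dominating {v = v} v-full x with v ≟ x
... | yes e = inj₁ e
... | no v≢x = inj₂ (v , refl , v-full x (v≢x ∘ sym))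

length≡1⇒∈-unique : ∀ {A : Set} {xs : List A} {a b} → length xs ≡ 1 → a ∈ xs → b ∈ xs → a ≡ b
length≡1⇒∈-unique {xs = _ ∷ []} _ (here refl) (here refl) = refl
length≡1⇒∈-unique {xs = _ ∷ []} _ _ (there ())
length≡1⇒∈-unique {xs = _ ∷ []} _ (there ()) _

deg≡1⇒unique-neighbour : ∀ {n} (G : Graph n) {x a b} →
                         deg G x ≡ 1 → adj G x a → adj G x b → a ≡ b
deg≡1⇒unique-neighbour G {x} {a} {b} d xa xb =
  length≡1⇒∈-unique d (∈-filter⁺ (adj? G x) (∈-allFin a) xa) (∈-filter⁺ (adj? G x) (∈-allFin b) xb)

Iso-K₂-of-Full : (G : Graph 2) {v : Fin 2} → Full G v → Iso G (K 2)
Iso-K₂-of-Full G {v} v-full = record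
  { to = id ; from = id ; from-to = λ _ → refl ; to-from = λ _ → refl
  ; pres = λ _ _ → adj⇒≢ G ; refl' = distinct⇒adj }
  where
  distinct⇒adj : ∀ a b → a ≢ b → adj G a b
  distinct⇒adj a b a≢b with Fin2-pigeonhole a b v a≢b
  ... | inj₁ refl = v-full b (a≢b ∘ sym)
  ... | inj₂ refl = adj-sym G (v-full a a≢b)

-- For p = c this is the star centred at c.
Spokes : ∀ {k} → Fin k → Fin k → Fin k → Fin k → Set
Spokes p c a b = (a ≡ c × b ≢ p × b ≢ c) ⊎ (b ≡ c × a ≢ p × a ≢ c)

Spokes-map : ∀ {k} {f : Fin k → Fin k} → (∀ {x y} → f x ≡ f y → x ≡ y) →
             ∀ {p c a b} → Spokes p c a b ⇔ Spokes (f p) (f c) (f a) (f b)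
Spokes-map {f = f} f-inj = mk⇔ mapped unmapped
  where
  mapped : ∀ {p c a b} → Spokes p c a b → Spokes (f p) (f c) (f a) (f b)
  mapped (inj₁ (e , n , n′)) = inj₁ (cong f e , n ∘ f-inj , n′ ∘ f-inj)
  mapped (inj₂ (e , n , n′)) = inj₂ (cong f e , n ∘ f-inj , n′ ∘ f-inj)
  unmapped : ∀ {p c a b} → Spokes (f p) (f c) (f a) (f b) → Spokes p c a b
  unmapped (inj₁ (e , n , n′)) = inj₁ (f-inj e , n ∘ cong f , n′ ∘ cong f)
  unmapped (inj₂ (e , n , n′)) = inj₂ (f-inj e , n ∘ cong f , n′ ∘ cong f)

permutation-injective : ∀ {k} (π : Permutation k k) {x y} → π ⟨$⟩ʳ x ≡ π ⟨$⟩ʳ y → x ≡ y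
permutation-injective π e = trans (sym (inverseˡ π)) (trans (cong (π ⟨$⟩ˡ_) e) (inverseˡ π))

Iso-bySpokes : ∀ {k} {X Y : Graph k} {p c p′ c′} (π : Permutation k k) →
               π ⟨$⟩ʳ p ≡ p′ → π ⟨$⟩ʳ c ≡ c′ →
               (∀ a b → adj X a b ⇔ Spokes p c a b) → (∀ a b → adj Y a b ⇔ Spokes p′ c′ a b) →
               Iso X Y
Iso-bySpokes π refl refl X-spokes Y-spokes = record
  { to = π ⟨$⟩ʳ_ ; from = π ⟨$⟩ˡ_ ; from-to = λ _ → inverseˡ π ; to-from = λ _ → inverseʳ π
  ; pres = λ a b → back (Y-spokes _ _) ∘ forth (Spokes-map (permutation-injective π)) ∘ forth (X-spokes a b)
  ; refl' = λ a b → back (X-spokes a b) ∘ back (Spokes-map (permutation-injective π)) ∘ forth (Y-spokes _ _) }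

transpose-sends : ∀ {k} (i j : Fin k) → transpose i j ⟨$⟩ʳ i ≡ j
transpose-sends i j rewrite dec-true (i ≟ i) refl = refl

transpose-fixes : ∀ {k} {i j x : Fin k} → x ≢ i → x ≢ j → transpose i j ⟨$⟩ʳ x ≡ x
transpose-fixes {i = i} {j} {x} x≢i x≢j rewrite dec-false (x ≟ i) x≢i | dec-false (x ≟ j) x≢j = refl

Permutation-sending : ∀ {k} {p c p′ c′ : Fin k} → p ≢ c → p′ ≢ c′ →
                      ∃ λ (π : Permutation k k) → π ⟨$⟩ʳ p ≡ p′ × π ⟨$⟩ʳ c ≡ c′
Permutation-sending {p = p} {c} {p′} {c′} p≢c p′≢c′ =
  σ ∘ₚ transpose (σ ⟨$⟩ʳ c) c′ , p↦p′ , transpose-sends (σ ⟨$⟩ʳ c) c′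
  where
  σ : Permutation _ _
  σ = transpose p p′
  p↦p′ : transpose (σ ⟨$⟩ʳ c) c′ ⟨$⟩ʳ (σ ⟨$⟩ʳ p) ≡ p′
  p↦p′ rewrite transpose-sends p p′ = transpose-fixes p′≢σc p′≢c′
    where
    p′≢σc : p′ ≢ σ ⟨$⟩ʳ c
    p′≢σc p′≡σc = p≢c (permutation-injective σ (trans (transpose-sends p p′) p′≡σc))

Star-spokes : ∀ m a b → adj (Star m) a b ⇔ Spokes zero zero a b
Star-spokes m a b = mk⇔ (λ { (inj₁ (e , n)) → inj₁ (e , n , n) ; (inj₂ (e , n)) → inj₂ (e , n , n) })
                        (λ { (inj₁ (e , n , _)) → inj₁ (e , n) ; (inj₂ (e , n , _)) → inj₂ (e , n) })

K₁⊔Star-spokes : ∀ m a b → adj (K 1 ⊔ Star (suc (suc m))) a b ⇔ Spokes zero (suc zero) a b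
K₁⊔Star-spokes m a b = mk⇔ (edge⇒spoke a b) (spoke⇒edge a b)
  where
  edge⇒spoke : ∀ a b → adj (K 1 ⊔ Star (suc (suc m))) a b → Spokes zero (suc zero) a b
  edge⇒spoke zero zero 0≢0 = ⊥-elim (0≢0 refl)
  edge⇒spoke (suc a) (suc b) (inj₁ (refl , b≢0)) = inj₁ (refl , (λ ()) , b≢0 ∘ suc-injective)
  edge⇒spoke (suc a) (suc b) (inj₂ (refl , a≢0)) = inj₂ (refl , (λ ()) , a≢0 ∘ suc-injective)
  spoke⇒edge : ∀ a b → Spokes zero (suc zero) a b → adj (K 1 ⊔ Star (suc (suc m))) a b
  spoke⇒edge _ zero (inj₁ (_ , b≢0 , _)) = ⊥-elim (b≢0 refl)
  spoke⇒edge _ (suc b) (inj₁ (refl , _ , b≢1)) = inj₁ (refl , b≢1 ∘ cong suc)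
  spoke⇒edge zero _ (inj₂ (_ , a≢0 , _)) = ⊥-elim (a≢0 refl)
  spoke⇒edge (suc a) _ (inj₂ (refl , _ , a≢1)) = inj₂ (refl , a≢1 ∘ cong suc)

module FullVertexAndLeaf {m} (G : Graph (suc (suc (suc m))))
                         {v} (v-full : Full G v) {w} (w-leaf : deg G w ≡ 1) where

  leaf≢full : w ≢ v
  leaf≢full w≡v = 0≢1+n (punchIn-injective v zero (suc zero)
    (deg≡1⇒unique-neighbour G w-leaf (neighbour zero) (neighbour (suc zero))))
    where
    neighbour : ∀ i → adj G w (punchIn v i)
    neighbour i = subst (λ x → adj G x (punchIn v i)) (sym w≡v) (v-full _ (punchInᵢ≢i v i))

  leaf-neighbour≡full : ∀ {x} → adj G w x → x ≡ v
  leaf-neighbour≡full wx = deg≡1⇒unique-neighbour G w-leaf wx (adj-sym G (v-full w leaf≢full))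

  ¬Dominating⇒≢full : ∀ {x} → ¬ Dominating G ｛ x ｝ → x ≢ v
  ¬Dominating⇒≢full ¬d refl = ¬d (Full⇒Dominating {G = G} v-full)

  Dominating⇒∋leaf-or-full : ∀ {D} → Dominating G D → D w ⊎ D v
  Dominating⇒∋leaf-or-full {D} d with d w
  ... | inj₁ Dw = inj₁ Dw
  ... | inj₂ (u , Du , uw) = inj₂ (subst D (leaf-neighbour≡full (adj-sym G uw)) Du)

  coalition-partner≡leaf : ∀ {u z} → u ≢ v → u ≢ w →
                           ¬ Dominating G ｛ z ｝ → Dominating G (｛ u ｝ ∪ ｛ z ｝) → z ≡ w
  coalition-partner≡leaf u≢v u≢w ¬dz d with Dominating⇒∋leaf-or-full d
  ... | inj₁ (inj₁ u≡w) = ⊥-elim (u≢w u≡w)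
  ... | inj₁ (inj₂ z≡w) = z≡w
  ... | inj₂ (inj₁ u≡v) = ⊥-elim (u≢v u≡v)
  ... | inj₂ (inj₂ z≡v) = ⊥-elim (¬Dominating⇒≢full ¬dz z≡v)

  module _ (sp : SP G) where

    coalition-with-leaf : ∀ {u} → u ≢ v → u ≢ w → Coalition G ｛ u ｝ ｛ w ｝
    coalition-with-leaf {u} u≢v u≢w with sp u
    ... | inj₁ d = ⊥-elim ([ u≢w , u≢v ] (Dominating⇒∋leaf-or-full d))
    ... | inj₂ (_ , z , _ , c@(_ , _ , ¬dz , d)) =
      subst (λ q → Coalition G ｛ u ｝ ｛ q ｝) (coalition-partner≡leaf u≢v u≢w ¬dz d) c

    CG-spokes : ∀ a b → adj (CG G) a b ⇔ Spokes v w a b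
    CG-spokes a b = mk⇔ coalition⇒spoke spoke⇒coalition
      where
      coalition⇒spoke : Coalition G ｛ a ｝ ｛ b ｝ → Spokes v w a b
      coalition⇒spoke (dj , ¬da , ¬db , d) with Dominating⇒∋leaf-or-full d
      ... | inj₁ (inj₁ a≡w) = inj₁ (a≡w , ¬Dominating⇒≢full ¬db , λ b≡w → dj a (refl , trans b≡w (sym a≡w)))
      ... | inj₁ (inj₂ b≡w) = inj₂ (b≡w , ¬Dominating⇒≢full ¬da , λ a≡w → dj a (refl , trans b≡w (sym a≡w)))
      ... | inj₂ (inj₁ a≡v) = ⊥-elim (¬Dominating⇒≢full ¬da a≡v)
      ... | inj₂ (inj₂ b≡v) = ⊥-elim (¬Dominating⇒≢full ¬db b≡v)

      spoke⇒coalition : Spokes v w a b → Coalition G ｛ a ｝ ｛ b ｝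
      spoke⇒coalition (inj₁ (refl , b≢v , b≢w)) = adj-sym (CG G) (coalition-with-leaf b≢v b≢w)
      spoke⇒coalition (inj₂ (refl , a≢v , a≢w)) = coalition-with-leaf a≢v a≢w

order-3-spokes : (G : Graph 3) {v : Fin 3} → Full G v → ∀ {w} → deg G w ≡ 1 →
                 ∀ a b → adj G a b ⇔ Spokes v v a b
order-3-spokes G {v} v-full {w} w-leaf a b = mk⇔ edge⇒spoke spoke⇒edge
  where
  open FullVertexAndLeaf G v-full w-leaf
  edge⇒spoke : adj G a b → Spokes v v a b
  edge⇒spoke ab with a ≟ v | b ≟ v
  ... | yes a≡v | _ = inj₁ (a≡v , b≢v , b≢v)
    where
    b≢v : b ≢ v
    b≢v b≡v = adj⇒≢ G ab (trans a≡v (sym b≡v))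
  ... | no a≢v | yes b≡v = inj₂ (b≡v , a≢v , a≢v)
  ... | no a≢v | no b≢v with Fin3-pigeonhole a b v w (adj⇒≢ G ab) a≢v b≢v leaf≢full
  ...   | inj₁ refl = ⊥-elim (b≢v (leaf-neighbour≡full ab))
  ...   | inj₂ refl = ⊥-elim (a≢v (leaf-neighbour≡full (adj-sym G ab)))
  spoke⇒edge : Spokes v v a b → adj G a b
  spoke⇒edge (inj₁ (refl , b≢v , _)) = v-full b b≢v
  spoke⇒edge (inj₂ (refl , a≢v , _)) = adj-sym G (v-full a a≢v)

part-a : ∀ {n} (G : Graph n) → ∃ (λ v → Full G v) → n ≡ 2 →
         Iso G (K 2) × LSCC G ∞
         × (∀ i → Iso (iter (2 * i) G) (K 2) × Iso (iter (suc (2 * i)) G) (Kbar 2))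
part-a G (_ , v-full) refl = G≅K₂ , LSCC-∞ SP-K₂ SP-K̄₂ {zero} (λ _ ()) K₂-¬Isolated , iter-even-odd
  where
  G≅K₂ : Iso G (K 2)
  G≅K₂ = Iso-K₂-of-Full G v-full
  open PeriodTwo G≅K₂ CG-K₂ CG-K̄₂

part-b : ∀ {n} (G : Graph n) → SP G → MinDegree G 1 → ∃ (λ v → Full G v) →
         3 < n → LSCC G (fin 1) → Iso (CG G) (K 1 ⊔ Star (n ∸ 2)) × ¬ SP (CG G)
part-b {suc (suc (suc (suc m)))} G sp (_ , w , w-leaf) (v , v-full) (s≤s (s≤s (s≤s (s≤s _))))
       (finLen _ (_ , ¬SP-CG) _) =
  let π , πv≡0 , πw≡1 = Permutation-sending (leaf≢full ∘ sym) 0≢1+n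
  in Iso-bySpokes π πv≡0 πw≡1 (CG-spokes sp) (K₁⊔Star-spokes m) , ¬SP-CG
  where open FullVertexAndLeaf G v-full w-leaf

part-c : ∀ {n} (G : Graph n) → MinDegree G 1 → ∃ (λ v → Full G v) → n ≡ 3 →
         Iso G (P 3) × LSCC G ∞
         × (∀ i → Iso (iter (2 * i) G) (P 3) × Iso (iter (suc (2 * i)) G) (K 1 ⊔ K 2))
part-c G (_ , w , w-leaf) (v , v-full) refl =
  G≅P₃ , LSCC-∞ SP-P₃ SP-K₁⊔K₂ {zero} K₁⊔K₂-Isolated P₃-¬Isolated , iter-even-odd
  where
  G≅P₃ : Iso G (P 3)
  G≅P₃ = Iso-trans (Iso-bySpokes (transpose v zero) (transpose-sends v zero) (transpose-sends v zero)
                                  (order-3-spokes G v-full w-leaf) (Star-spokes 2))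
                   Star₂≅P₃
  open PeriodTwo G≅P₃ CG-P₃ CG-K₁⊔K₂

theorem9 : ∀ {n} (G : Graph n) → SP G → MinDegree G 1 → ∃ (λ v → Full G v) →
    (n ≡ 2 → Iso G (K 2) × LSCC G ∞
       × (∀ i → Iso (iter (2 * i) G) (K 2) × Iso (iter (suc (2 * i)) G) (Kbar 2)))
    × (3 < n → LSCC G (fin 1) →
       Iso (CG G) (K 1 ⊔ Star (n ∸ 2)) × ¬ SP (CG G))
    × (n ≡ 3 → Iso G (P 3) × LSCC G ∞
       × (∀ i → Iso (iter (2 * i) G) (P 3) × Iso (iter (suc (2 * i)) G) (K 1 ⊔ K 2)))
theorem9 G sp δ≡1 full = part-a G full , part-b G sp δ≡1 full , part-c G δ≡1 full
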